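{- Let $R$ be a commutative ring with unit, let $q\in R$ be such that $R$ is $q$-torsion free and $qR$ is a prime ideal of $R$, and let $n\geq 2$ and $d\geq 1$ be integers. Then the set $$\widetilde{A}_d(n,R,q)=\{\psi\in \mathrm{Aut}(\mathbb{A}^1_{R/q^{n}}) : \deg(\psi \bmod q^m)\leq 2^{m-2}d \text{ for all } 2\leq m\leq n\}$$ is a subgroup of $\mathrm{Aut}(\mathbb{A}^1_{R/q^n})$.
   Context: For a commutative ring $B$, $\mathrm{Aut}(\mathbb{A}^1_B)$ denotes the group of polynomials $f\in B[T]$ that are invertible under composition (equivalently, $T\mapsto f(T)$ defines a $B$-algebra automorphism of $B[T]$), with group law composition of polynomials. For $\psi\in (R/q^n)[T]$ and $m\leq n$, $\psi\bmod q^m$ denotes the image of $\psi$ in $(R/q^m)[T]$, and $\deg$ is its degree there. -}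

module Defs where

open import Level using (_⊔_)
open import Algebra.Bundles using (CommutativeRing)
open import Data.Nat as ℕ using (ℕ; zero; suc; _∸_)
open import Data.List using (List; []; _∷_)
open import Data.Product using (Σ; _×_; _,_)
open import Data.Sum using (_⊎_)
open import Relation.Nullary using (¬_)

module Poly {c ℓ} (R : CommutativeRing c ℓ) where
  open CommutativeRing R

  pow : Carrier → ℕ → Carrier
  pow x zero    = 1#
  pow x (suc m) = x * pow x m

  _∣R_ : Carrier → Carrier → Set (c ⊔ ℓ)
  a ∣R b = Σ Carrier λ y → b ≈ a * y

  TorsionFree : Carrier → Set (c ⊔ ℓ)
  TorsionFree q = ∀ x → q * x ≈ 0# → x ≈ 0#

  PrimePrincipal : Carrier → Set (c ⊔ ℓ)
  PrimePrincipal q = (¬ (q ∣R 1#)) × (∀ a b → q ∣R (a * b) → (q ∣R a) ⊎ (q ∣R b))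

  -- Polynomials in R[T] as coefficient lists (constant term first).
  -- A polynomial over R/q^n is represented by any lift to R[T]; equality
  -- in (R/q^n)[T] is coefficientwise congruence modulo q^n (see _≡[_]_).
  Pol : Set c
  Pol = List Carrier

  coeff : Pol → ℕ → Carrier
  coeff []      _       = 0#
  coeff (a ∷ p) zero    = a
  coeff (a ∷ p) (suc i) = coeff p i

  _+P_ : Pol → Pol → Pol
  []      +P g       = g
  (a ∷ f) +P []      = a ∷ f
  (a ∷ f) +P (b ∷ g) = (a + b) ∷ (f +P g)

  scale : Carrier → Pol → Pol
  scale a []      = []
  scale a (b ∷ g) = (a * b) ∷ scale a g

  _*P_ : Pol → Pol → Pol
  []      *P g = []
  (a ∷ f) *P g = scale a g +P (0# ∷ (f *P g))

  _∘P_ : Pol → Pol → Pol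
  []      ∘P g = []
  (a ∷ f) ∘P g = (a ∷ []) +P (g *P (f ∘P g))

  Tpol : Pol
  Tpol = 0# ∷ 1# ∷ []

  module Mod (q : Carrier) where

    _≡[_]_ : Pol → ℕ → Pol → Set (c ⊔ ℓ)
    f ≡[ m ] g = ∀ i → pow q m ∣R (coeff f i - coeff g i)

    InvMod : ℕ → Pol → Pol → Set (c ⊔ ℓ)
    InvMod n f g = ((f ∘P g) ≡[ n ] Tpol) × ((g ∘P f) ≡[ n ] Tpol)

    IsAut : ℕ → Pol → Set (c ⊔ ℓ)
    IsAut n f = Σ Pol λ g → InvMod n f g

    DegLe : ℕ → ℕ → Pol → Set (c ⊔ ℓ)
    DegLe m D f = ∀ i → D ℕ.< i → pow q m ∣R coeff f i

    Atilde : ℕ → ℕ → Pol → Set (c ⊔ ℓ)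
    Atilde d n ψ = IsAut n ψ
                 × (∀ m → 2 ℕ.≤ m → m ℕ.≤ n → DegLe m (2 ℕ.^ (m ∸ 2) ℕ.* d) ψ)

    -- a subset S of Aut(A^1_{R/q^n}) (given by a predicate on lifts) is a subgroup:
    -- S ⊆ Aut, well defined on classes mod q^n, contains T,
    -- closed under composition and under taking inverses
    IsSubgroup : ℕ → (Pol → Set (c ⊔ ℓ)) → Set (c ⊔ ℓ)
    IsSubgroup n S =
        (∀ f → S f → IsAut n f)
      × (∀ f g → f ≡[ n ] g → S f → S g)
      × S Tpol
      × (∀ f g → S f → S g → S (f ∘P g))
      × (∀ f g → S f → InvMod n f g → S g)

module Submission where

open import Defs
open import Algebra.Bundles using (CommutativeRing)
open import Data.Nat using (ℕ; _≤_)

open import Data.Nat using (zero; suc; z≤n; s≤s; _<_)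
import Data.Nat as ℕ
import Data.Nat.Properties as ℕₚ
open import Data.List using ([]; _∷_; length; take)
open import Data.Product using (_,_; proj₁; proj₂; swap)
open import Data.Sum using (_⊎_; inj₁; inj₂; [_,_]′)
open import Data.Empty using (⊥-elim)
open import Function using (const)
open import Level using (_⊔_)
open import Relation.Nullary using (¬_; yes; no; contradiction)
open import Relation.Binary.Bundles using (Setoid)
import Relation.Binary.PropositionalEquality as P
import Relation.Binary.Reasoning.Setoid

-- Encode the degree conditions as divisibility with a weight: f is
-- w-divisible when q^(w i) divides its i-th coefficient. With thresholds
-- th 1 = 1 and th m = 2^(m-2) d (m ≥ 2), let wt n i be the largest m ≤ n
-- with th m < i. Then wt n-divisibility means: linear modulo q, and of
-- degree ≤ 2^(m-2) d modulo q^m for 2 ≤ m ≤ n; linearity modulo q holds for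
-- every automorphism because qR is prime. The weight wt n vanishes at 0
-- and 1, is monotone, and subadditive on arguments ≥ 2 (as th doubles),
-- and such weights make w-divisibility stable under composition: this
-- gives closure under ∘. For the inverse g of ψ ∈ Ã we show by induction
-- on m that g is wt m-divisible: truncating g at degree th (m+1) leaves a
-- remainder H ≡ 0 modulo q^m, a first-order Taylor expansion gives
-- ψ(g) ≡ ψ(g̃) + ψ₁ H modulo q^(m+1), and q ∤ ψ₁ together with
-- torsion-freeness forces H ≡ 0 modulo q^(m+1) beyond degree th (m+1).

module Weights where
  open import Data.Nat using (_+_; _*_; _^_; _<?_)
  open import Data.Nat.Properties
  open import Relation.Binary.PropositionalEquality using (_≡_; refl; sym; trans; subst)
  open import Algebra.Properties.CommutativeSemigroup +-commutativeSemigroup using (x∙yz≈y∙xz)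

  -- A weight w prescribes the power q^(w i) dividing the i-th coefficient.
  -- These axioms are what makes weighted divisibility stable under
  -- composition of polynomials.
  record Weight (w : ℕ → ℕ) : Set where
    field
      at-0        : w 0 ≡ 0
      at-1        : w 1 ≡ 0
      monotone    : ∀ {a b} → a ≤ b → w a ≤ w b
      subadditive : ∀ a b → 2 ≤ a → 2 ≤ b → w (a + b) ≤ w a + w b

  module _ {w : ℕ → ℕ} (W : Weight w) where
    open Weight W

    -- The inequality behind one Horner step of a composition f ∘ g: the
    -- coefficient of T^(i+j) in g · (h ∘ g), where h is f with its first
    -- s+1 coefficients dropped.
    horner-bound : ∀ s i j → w (s + (i + j)) ≤ w i + w (suc s + j)
    horner-bound s zero j rewrite at-0 = monotone (n≤1+n (s + j))
    horner-bound s (suc zero) j rewrite at-1 | +-suc s j = ≤-refl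
    horner-bound s i@(suc (suc _)) j rewrite x∙yz≈y∙xz s i j with s + j
    ... | zero rewrite +-identityʳ i = m≤m+n (w i) (w 1)
    ... | suc t = ≤-trans (monotone (+-monoʳ-≤ i (n≤1+n (suc t))))
                          (subadditive i (suc (suc t)) (s≤s (s≤s z≤n)) (s≤s (s≤s z≤n)))

  positive-case : ∀ {x y} → (1 ≤ x → x ≤ y) → x ≤ y
  positive-case {zero}  _ = z≤n
  positive-case {suc x} h = h (s≤s z≤n)

  -- The degree thresholds of Ã_d: linear modulo q, and degree at most
  -- 2^(m-2)·d modulo q^m for m ≥ 2.
  module Threshold (d : ℕ) (1≤d : 1 ≤ d) where
    th : ℕ → ℕ
    th zero          = 0
    th (suc zero)    = 1
    th (suc (suc k)) = 2 ^ k * d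

    -- wt k i is the largest level m ≤ k with th m < i (0 if there is none):
    -- the power of q that the bounds up to level k force on coefficient i.
    wt : ℕ → ℕ → ℕ
    wt zero    i = 0
    wt (suc k) i with th (suc k) <? i
    ... | yes _ = suc k
    ... | no  _ = wt k i

    th-positive : ∀ m → 1 ≤ m → 1 ≤ th m
    th-positive (suc zero)    _ = ≤-refl
    th-positive (suc (suc k)) _ = *-mono-≤ (m^n>0 2 k) 1≤d

    th-step : ∀ m → 1 ≤ m → th m ≤ th (suc m)
    th-step (suc zero)    _ = ≤-trans 1≤d (m≤m+n d 0)
    th-step (suc (suc k)) _ = *-monoˡ-≤ d (m≤m+n (2 ^ k) _)

    th-double : ∀ k → th (3 + k) ≡ 2 * th (2 + k)
    th-double k = *-assoc 2 (2 ^ k) d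

    wt-≤ : ∀ k i → wt k i ≤ k
    wt-≤ zero    i = z≤n
    wt-≤ (suc k) i with th (suc k) <? i
    ... | yes _ = ≤-refl
    ... | no  _ = m≤n⇒m≤1+n (wt-≤ k i)

    wt-< : ∀ k i → 1 ≤ wt k i → th (wt k i) < i
    wt-< (suc k) i 1≤w with th (suc k) <? i
    ... | yes th<i = th<i
    ... | no  _    = wt-< k i 1≤w

    wt-greatest : ∀ k i m → 1 ≤ m → m ≤ k → th m < i → m ≤ wt k i
    wt-greatest zero    i (suc m) _ () _
    wt-greatest (suc k) i m 1≤m m≤k th<i with th (suc k) <? i
    ... | yes _ = m≤k
    ... | no ¬th<i with m≤n⇒m<n∨m≡n m≤k
    ...   | inj₁ (s≤s m≤k') = wt-greatest k i m 1≤m m≤k' th<i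
    ...   | inj₂ refl       = contradiction th<i ¬th<i

    wt-monotone : ∀ k {i i'} → i ≤ i' → wt k i ≤ wt k i'
    wt-monotone k {i} {i'} i≤i' = positive-case λ 1≤w →
      wt-greatest k i' (wt k i) 1≤w (wt-≤ k i) (<-≤-trans (wt-< k i 1≤w) i≤i')

    wt-level-monotone : ∀ {k k'} i → k ≤ k' → wt k i ≤ wt k' i
    wt-level-monotone {k} i k≤k' = positive-case λ 1≤w →
      wt-greatest _ i (wt k i) 1≤w (≤-trans (wt-≤ k i) k≤k') (wt-< k i 1≤w)

    wt-small : ∀ k i → i ≤ 1 → wt k i ≡ 0
    wt-small k i i≤1 = n≤0⇒n≡0 (positive-case λ 1≤w →
      ⊥-elim (2≰1 (≤-trans (s≤s (th-positive _ 1≤w)) (≤-trans (wt-< k i 1≤w) i≤1))))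
      where
      2≰1 : ¬ 2 ≤ 1
      2≰1 (s≤s ())

    half-< : ∀ x a b → b ≤ a → 2 * x < a + b → x < a
    half-< x a b b≤a 2x<a+b with x <? a
    ... | yes x<a = x<a
    ... | no  x≮a = contradiction 2x<a+b (≤⇒≯ (+-mono-≤ a≤x (≤-trans b≤a (≤-trans a≤x (≤-reflexive (sym (+-identityʳ x)))))))
      where a≤x = ≮⇒≥ x≮a

    -- Subadditivity rests on th (m+1) = 2 th m for m ≥ 2: if th m < a + b then
    -- th (m-1) is below the larger of a and b.
    wt-subadditive : ∀ k a b → 2 ≤ a → 2 ≤ b → wt k (a + b) ≤ wt k a + wt k b
    wt-subadditive k a b 2≤a 2≤b = positive-case λ 1≤w →
      bound (wt k (a + b)) (≤-trans 1≤w (wt-≤ k (a + b))) (wt-≤ k (a + b)) (wt-< k (a + b) 1≤w)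
      where
      bound : ∀ m → 1 ≤ k → m ≤ k → th m < a + b → m ≤ wt k a + wt k b
      bound zero _ _ _ = z≤n
      bound (suc zero) 1≤k _ _ = ≤-trans (wt-greatest k a 1 ≤-refl 1≤k 2≤a) (m≤m+n _ _)
      bound (suc (suc zero)) 1≤k _ _ = +-mono-≤ (wt-greatest k a 1 ≤-refl 1≤k 2≤a) (wt-greatest k b 1 ≤-refl 1≤k 2≤b)
      bound (suc (suc (suc t))) 1≤k m≤k th<a+b with ≤-total b a
      ... | inj₁ b≤a = subst (_≤ wt k a + wt k b) (+-comm (2 + t) 1)
            (+-mono-≤ (wt-greatest k a (2 + t) (s≤s z≤n) (≤-trans (n≤1+n _) m≤k)
                        (half-< _ a b b≤a (subst (_< a + b) (th-double t) th<a+b)))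
                      (wt-greatest k b 1 ≤-refl 1≤k 2≤b))
      ... | inj₂ a≤b =
            +-mono-≤ (wt-greatest k a 1 ≤-refl 1≤k 2≤a)
                     (wt-greatest k b (2 + t) (s≤s z≤n) (≤-trans (n≤1+n _) m≤k)
                        (half-< _ b a a≤b (subst (_< b + a) (th-double t) (subst (th (3 + t) <_) (+-comm a b) th<a+b))))

    weight : ∀ k → Weight (wt k)
    weight k = record
      { at-0        = wt-small k 0 z≤n
      ; at-1        = wt-small k 1 ≤-refl
      ; monotone    = wt-monotone k
      ; subadditive = wt-subadditive k
      }

    wt-reaches : ∀ k i → th (suc k) < i → k ≤ wt k i
    wt-reaches zero    i _    = z≤n
    wt-reaches (suc k) i th<i =
      wt-greatest (suc k) i (suc k) (s≤s z≤n) ≤-refl (≤-<-trans (th-step (suc k) (s≤s z≤n)) th<i)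

    wt-top : ∀ k i → th (suc k) < i → wt (suc k) i ≡ suc k
    wt-top k i th<i with th (suc k) <? i
    ... | yes _    = refl
    ... | no ¬th<i = contradiction th<i ¬th<i

    wt-not-top : ∀ k i → ¬ th (suc k) < i → wt (suc k) i ≡ wt k i
    wt-not-top k i ¬th<i with th (suc k) <? i
    ... | yes th<i = contradiction th<i ¬th<i
    ... | no  _    = refl

  -- above D i = 1 for i > D and 0 otherwise; divisibility with this weight
  -- says that a polynomial has degree at most D modulo q.
  above : ℕ → ℕ → ℕ
  above D       zero    = 0
  above zero    (suc i) = 1
  above (suc D) (suc i) = above D i

  above-≤1 : ∀ D i → above D i ≤ 1
  above-≤1 D       zero    = z≤n
  above-≤1 zero    (suc i) = ≤-refl
  above-≤1 (suc D) (suc i) = above-≤1 D i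

  above-beyond : ∀ {D i} → D < i → above D i ≡ 1
  above-beyond {D}     {zero}  ()
  above-beyond {zero}  {suc i} _           = refl
  above-beyond {suc D} {suc i} (s≤s D<i) = above-beyond D<i

  above-within : ∀ {D i} → i ≤ D → above D i ≡ 0
  above-within {D}     {zero}  _           = refl
  above-within {zero}  {suc i} ()
  above-within {suc D} {suc i} (s≤s i≤D) = above-within i≤D

  above-+ : ∀ x y i j → above (x + y) (i + j) ≤ above x i + above y j
  above-+ x y i j with x <? i | y <? j
  ... | yes x<i | _       rewrite above-beyond x<i = ≤-trans (above-≤1 (x + y) (i + j)) (m≤m+n 1 _)
  ... | no _    | yes y<j rewrite above-beyond y<j = ≤-trans (above-≤1 (x + y) (i + j)) (m≤n+m 1 _)
  ... | no x≮i | no y≮j rewrite above-within (+-mono-≤ (≮⇒≥ x≮i) (≮⇒≥ y≮j)) = z≤n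

  above-antitone : ∀ {D D'} i → D ≤ D' → above D' i ≤ above D i
  above-antitone {D} {D'} i D≤D' with D' <? i
  ... | yes D'<i = ≤-reflexive (trans (above-beyond D'<i) (sym (above-beyond (≤-<-trans D≤D' D'<i))))
  ... | no  D'≮i rewrite above-within {D'} {i} (≮⇒≥ D'≮i) = z≤n

module Divisibility {c ℓ} (R : CommutativeRing c ℓ) where
  open CommutativeRing R
  open Poly R using (pow; _∣R_)
  open import Algebra.Properties.Ring ring using (x[y-z]≈xy-xz; -‿distribʳ-*)
  open import Algebra.Properties.AbelianGroup +-abelianGroup using (⁻¹-anti-homo‿-; ⁻¹-∙-comm)
  open import Algebra.Properties.Group +-group using (x≈y⇒x∙y⁻¹≈ε; ε⁻¹≈ε; //-rightDividesˡ)
  open import Algebra.Properties.CommutativeSemigroup +-commutativeSemigroup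
    using () renaming (interchange to +-interchange)
  open import Algebra.Properties.CommutativeSemigroup *-commutativeSemigroup
    using () renaming (interchange to *-interchange; x∙yz≈y∙xz to *-exchange)

  ∣-resp : ∀ {a x y} → x ≈ y → a ∣R x → a ∣R y
  ∣-resp x≈y (z , x≈az) = z , trans (sym x≈y) x≈az

  ∣-0 : ∀ {a} → a ∣R 0#
  ∣-0 {a} = 0# , sym (zeroʳ a)

  ∣-refl : ∀ {a} → a ∣R a
  ∣-refl {a} = 1# , sym (*-identityʳ a)

  1∣ : ∀ {x} → 1# ∣R x
  1∣ {x} = x , sym (*-identityˡ x)

  ∣-trans : ∀ {a b x} → a ∣R b → b ∣R x → a ∣R x
  ∣-trans {a} (u , b≈au) (v , x≈bv) = u * v , trans x≈bv (trans (*-congʳ b≈au) (*-assoc a u v))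

  ∣-+ : ∀ {a x y} → a ∣R x → a ∣R y → a ∣R (x + y)
  ∣-+ {a} (u , x≈au) (v , y≈av) = u + v , trans (+-cong x≈au y≈av) (sym (distribˡ a u v))

  ∣-*ˡ : ∀ {a x} z → a ∣R x → a ∣R (z * x)
  ∣-*ˡ {a} z (u , x≈au) = z * u , trans (*-congˡ x≈au) (*-exchange z a u)

  ∣-*ʳ : ∀ {a x} z → a ∣R x → a ∣R (x * z)
  ∣-*ʳ {a} z (u , x≈au) = u * z , trans (*-congʳ x≈au) (*-assoc a u z)

  ∣-neg : ∀ {a x} → a ∣R x → a ∣R (- x)
  ∣-neg {a} {x} (u , x≈au) = - u , trans (-‿cong x≈au) (-‿distribʳ-* a u)

  ∣-* : ∀ {a b x y} → a ∣R x → b ∣R y → (a * b) ∣R (x * y)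
  ∣-* {a} {b} (u , x≈au) (v , y≈bv) = u * v , trans (*-cong x≈au y≈bv) (*-interchange a u b v)

  pow-+ : ∀ x m k → pow x (m ℕ.+ k) ≈ pow x m * pow x k
  pow-+ x zero    k = sym (*-identityˡ (pow x k))
  pow-+ x (suc m) k = trans (*-congˡ (pow-+ x m k)) (sym (*-assoc x (pow x m) (pow x k)))

  pow-∣ : ∀ x {m k} → m ≤ k → pow x m ∣R pow x k
  pow-∣ x {m} m≤k with ℕₚ.m≤n⇒∃[o]m+o≡n m≤k
  ... | o , P.refl = pow x o , pow-+ x m o

  infix 4 _≡_mod_
  _≡_mod_ : Carrier → Carrier → Carrier → Set (c ⊔ ℓ)
  x ≡ y mod a = a ∣R (x - y)

  mod-reflexive : ∀ {a x y} → x ≈ y → x ≡ y mod a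
  mod-reflexive x≈y = ∣-resp (sym (x≈y⇒x∙y⁻¹≈ε x≈y)) ∣-0

  mod-sym : ∀ {a x y} → x ≡ y mod a → y ≡ x mod a
  mod-sym {x = x} {y} d = ∣-resp (⁻¹-anti-homo‿- x y) (∣-neg d)

  mod-trans : ∀ {a x y z} → x ≡ y mod a → y ≡ z mod a → x ≡ z mod a
  mod-trans {x = x} {y} {z} d e = ∣-resp telescope (∣-+ d e)
    where
    open import Relation.Binary.Reasoning.Setoid setoid
    telescope : (x - y) + (y - z) ≈ x - z
    telescope = begin
      (x - y) + (y - z)    ≈⟨ +-assoc x (- y) (y - z) ⟩
      x + (- y + (y - z))  ≈⟨ +-congˡ (+-assoc (- y) y (- z)) ⟨
      x + ((- y + y) - z)  ≈⟨ +-congˡ (+-congʳ (-‿inverseˡ y)) ⟩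
      x + (0# - z)         ≈⟨ +-congˡ (+-identityˡ (- z)) ⟩
      x - z                ∎

  mod-+ : ∀ {a x x' y y'} → x ≡ x' mod a → y ≡ y' mod a → x + y ≡ x' + y' mod a
  mod-+ {x = x} {x'} {y} {y'} d e =
    ∣-resp (trans (+-interchange x (- x') y (- y')) (+-congˡ (⁻¹-∙-comm x' y'))) (∣-+ d e)

  mod-*ˡ : ∀ {a x y} z → x ≡ y mod a → z * x ≡ z * y mod a
  mod-*ˡ {x = x} {y} z d = ∣-resp (x[y-z]≈xy-xz z x y) (∣-*ˡ z d)

  mod-coarser : ∀ {a b x y} → a ∣R b → x ≡ y mod b → x ≡ y mod a
  mod-coarser = ∣-trans

  mod-∣ : ∀ {a x y} → x ≡ y mod a → a ∣R y → a ∣R x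
  mod-∣ {x = x} {y} d e = ∣-resp (//-rightDividesˡ y x) (∣-+ d e)

  x-0≈x : ∀ x → x - 0# ≈ x
  x-0≈x x = trans (+-congˡ ε⁻¹≈ε) (+-identityʳ x)

  mod-zero : ∀ {a x} → a ∣R x → x ≡ 0# mod a
  mod-zero {x = x} = ∣-resp (sym (x-0≈x x))

  mod-setoid : Carrier → Setoid c (c ⊔ ℓ)
  mod-setoid a = record
    { Carrier = Carrier ; _≈_ = λ x y → x ≡ y mod a
    ; isEquivalence = record { refl = mod-reflexive refl ; sym = mod-sym ; trans = mod-trans } }

  module mod-Reasoning (a : Carrier) = Relation.Binary.Reasoning.Setoid (mod-setoid a)

module Polynomials {c ℓ} (R : CommutativeRing c ℓ) where
  open CommutativeRing R
  open Poly R
  open import Algebra.Properties.Ring ring using (-1*x≈-x)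
  open import Algebra.Properties.CommutativeSemigroup +-commutativeSemigroup
    using () renaming (interchange to +-interchange; x∙yz≈y∙xz to +-exchange)
  open import Algebra.Properties.CommutativeSemigroup *-commutativeSemigroup
    using () renaming (x∙yz≈y∙xz to *-exchange)

  -- Coefficientwise equality, i.e. equality in R[T]. It is a record so
  -- that the two polynomials can be inferred from a proof.
  infix 4 _≋_
  record _≋_ (f g : Pol) : Set ℓ where
    constructor mk≋
    field at : ∀ i → coeff f i ≈ coeff g i
  open _≋_ public

  ≋-refl : ∀ {f} → f ≋ f
  ≋-refl = mk≋ λ _ → refl

  ≋-sym : ∀ {f g} → f ≋ g → g ≋ f
  ≋-sym e = mk≋ λ i → sym (at e i)

  ≋-trans : ∀ {f g h} → f ≋ g → g ≋ h → f ≋ h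
  ≋-trans e e' = mk≋ λ i → trans (at e i) (at e' i)

  ≋-setoid : Setoid c ℓ
  ≋-setoid = record
    { Carrier = Pol ; _≈_ = _≋_
    ; isEquivalence = record { refl = ≋-refl ; sym = ≋-sym ; trans = ≋-trans } }

  module ≋-Reasoning = Relation.Binary.Reasoning.Setoid ≋-setoid

  ∷-cong : ∀ {a b f g} → a ≈ b → f ≋ g → (a ∷ f) ≋ (b ∷ g)
  ∷-cong a≈b f≋g = mk≋ λ { zero → a≈b ; (suc i) → at f≋g i }

  ∷-≋[] : ∀ {a f} → a ≈ 0# → f ≋ [] → (a ∷ f) ≋ []
  ∷-≋[] a≈0 f≋[] = mk≋ λ { zero → a≈0 ; (suc i) → at f≋[] i }

  tail-≋ : ∀ {a b f g} → (a ∷ f) ≋ (b ∷ g) → f ≋ g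
  tail-≋ e = mk≋ λ i → at e (suc i)

  tail-≋[] : ∀ {a f} → (a ∷ f) ≋ [] → f ≋ []
  tail-≋[] e = mk≋ λ i → at e (suc i)

  coeff-+P : ∀ f g i → coeff (f +P g) i ≈ coeff f i + coeff g i
  coeff-+P []      g       i       = sym (+-identityˡ _)
  coeff-+P (a ∷ f) []      i       = sym (+-identityʳ _)
  coeff-+P (a ∷ f) (b ∷ g) zero    = refl
  coeff-+P (a ∷ f) (b ∷ g) (suc i) = coeff-+P f g i

  coeff-scale : ∀ a f i → coeff (scale a f) i ≈ a * coeff f i
  coeff-scale a []      i       = sym (zeroʳ a)
  coeff-scale a (b ∷ f) zero    = refl
  coeff-scale a (b ∷ f) (suc i) = coeff-scale a f i

  +P-cong : ∀ {f f' g g'} → f ≋ f' → g ≋ g' → (f +P g) ≋ (f' +P g')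
  +P-cong {f} {f'} {g} {g'} e e' = mk≋ λ i →
    trans (coeff-+P f g i) (trans (+-cong (at e i) (at e' i)) (sym (coeff-+P f' g' i)))

  -- As in the standard library, congˡ varies the right argument and congʳ the left one.
  +P-congˡ : ∀ {f g g'} → g ≋ g' → (f +P g) ≋ (f +P g')
  +P-congˡ = +P-cong ≋-refl

  +P-congʳ : ∀ {f f' g} → f ≋ f' → (f +P g) ≋ (f' +P g)
  +P-congʳ e = +P-cong e ≋-refl

  scale-cong : ∀ {a a' f f'} → a ≈ a' → f ≋ f' → scale a f ≋ scale a' f'
  scale-cong {a} {a'} {f} {f'} e e' = mk≋ λ i →
    trans (coeff-scale a f i) (trans (*-cong e (at e' i)) (sym (coeff-scale a' f' i)))

  +P-assoc : ∀ f g h → ((f +P g) +P h) ≋ (f +P (g +P h))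
  +P-assoc f g h = mk≋ λ i →
    trans (coeff-+P (f +P g) h i) (trans (+-congʳ (coeff-+P f g i)) (trans (+-assoc _ _ _)
      (sym (trans (coeff-+P f (g +P h) i) (+-congˡ (coeff-+P g h i))))))

  +P-interchange : ∀ f g h k → ((f +P g) +P (h +P k)) ≋ ((f +P h) +P (g +P k))
  +P-interchange f g h k = mk≋ λ i →
    trans (coeff-+P (f +P g) (h +P k) i) (trans (+-cong (coeff-+P f g i) (coeff-+P h k i))
      (trans (+-interchange _ _ _ _)
        (sym (trans (coeff-+P (f +P h) (g +P k) i) (+-cong (coeff-+P f h i) (coeff-+P g k i))))))

  +P-exchange : ∀ f g h → (f +P (g +P h)) ≋ (g +P (f +P h))
  +P-exchange f g h = mk≋ λ i →
    trans (coeff-+P f (g +P h) i) (trans (+-congˡ (coeff-+P g h i)) (trans (+-exchange _ _ _)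
      (sym (trans (coeff-+P g (f +P h) i) (+-congˡ (coeff-+P f h i))))))

  +P-identityʳ : ∀ f → (f +P []) ≋ f
  +P-identityʳ f = mk≋ λ i → trans (coeff-+P f [] i) (+-identityʳ _)

  +P-≋[]ˡ : ∀ f g → f ≋ [] → (f +P g) ≋ g
  +P-≋[]ˡ f g e = mk≋ λ i → trans (coeff-+P f g i) (trans (+-congʳ (at e i)) (+-identityˡ _))

  ∷0-+P : ∀ f g → ((0# ∷ f) +P (0# ∷ g)) ≋ (0# ∷ (f +P g))
  ∷0-+P f g = ∷-cong (+-identityˡ 0#) ≋-refl

  scale-distribʳ : ∀ a b h → scale (a + b) h ≋ (scale a h +P scale b h)
  scale-distribʳ a b h = mk≋ λ i →
    trans (coeff-scale (a + b) h i) (trans (distribʳ _ a b)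
      (sym (trans (coeff-+P (scale a h) (scale b h) i) (+-cong (coeff-scale a h i) (coeff-scale b h i)))))

  scale-distribˡ : ∀ a f g → scale a (f +P g) ≋ (scale a f +P scale a g)
  scale-distribˡ a f g = mk≋ λ i →
    trans (coeff-scale a (f +P g) i) (trans (*-congˡ (coeff-+P f g i)) (trans (distribˡ a _ _)
      (sym (trans (coeff-+P (scale a f) (scale a g) i) (+-cong (coeff-scale a f i) (coeff-scale a g i))))))

  scale-assoc : ∀ a b g → scale (a * b) g ≋ scale a (scale b g)
  scale-assoc a b g = mk≋ λ i →
    trans (coeff-scale (a * b) g i) (trans (*-assoc a b _)
      (sym (trans (coeff-scale a (scale b g) i) (*-congˡ (coeff-scale b g i)))))

  scale-exchange : ∀ a b g → scale a (scale b g) ≋ scale b (scale a g)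
  scale-exchange a b g = mk≋ λ i →
    trans (coeff-scale a (scale b g) i) (trans (*-congˡ (coeff-scale b g i)) (trans (*-exchange a b _)
      (sym (trans (coeff-scale b (scale a g) i) (*-congˡ (coeff-scale a g i))))))

  scale-zero : ∀ g → scale 0# g ≋ []
  scale-zero g = mk≋ λ i → trans (coeff-scale 0# g i) (zeroˡ _)

  scale-identity : ∀ g → scale 1# g ≋ g
  scale-identity g = mk≋ λ i → trans (coeff-scale 1# g i) (*-identityˡ _)

  scale-∷0 : ∀ a f → scale a (0# ∷ f) ≋ (0# ∷ scale a f)
  scale-∷0 a f = ∷-cong (zeroʳ a) ≋-refl

  *P-≋[]ˡ : ∀ f g → f ≋ [] → (f *P g) ≋ []
  *P-≋[]ˡ []      g e = ≋-refl
  *P-≋[]ˡ (a ∷ f) g e =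
    ≋-trans (+P-cong (≋-trans (scale-cong (at e 0) ≋-refl) (scale-zero g))
                     (∷-≋[] refl (*P-≋[]ˡ f g (tail-≋[] e))))
            (+P-identityʳ [])

  *P-zeroʳ : ∀ f → (f *P []) ≋ []
  *P-zeroʳ []      = ≋-refl
  *P-zeroʳ (a ∷ f) = ∷-≋[] refl (*P-zeroʳ f)

  *P-congʳ : ∀ f f' g → f ≋ f' → (f *P g) ≋ (f' *P g)
  *P-congʳ []      []       g e = ≋-refl
  *P-congʳ []      (b ∷ f') g e = ≋-sym (*P-≋[]ˡ (b ∷ f') g (≋-sym e))
  *P-congʳ (a ∷ f) []       g e = *P-≋[]ˡ (a ∷ f) g e
  *P-congʳ (a ∷ f) (b ∷ f') g e =
    +P-cong (scale-cong (at e 0) ≋-refl) (∷-cong refl (*P-congʳ f f' g (tail-≋ e)))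

  *P-congˡ : ∀ f g g' → g ≋ g' → (f *P g) ≋ (f *P g')
  *P-congˡ []      g g' e = ≋-refl
  *P-congˡ (a ∷ f) g g' e = +P-cong (scale-cong refl e) (∷-cong refl (*P-congˡ f g g' e))

  *P-cong : ∀ {f f' g g'} → f ≋ f' → g ≋ g' → (f *P g) ≋ (f' *P g')
  *P-cong {f} {f'} {g} {g'} e e' = ≋-trans (*P-congʳ f f' g e) (*P-congˡ f' g g' e')

  *P-distribʳ : ∀ f g h → ((f +P g) *P h) ≋ ((f *P h) +P (g *P h))
  *P-distribʳ []      g       h = ≋-refl
  *P-distribʳ (a ∷ f) []      h = ≋-sym (+P-identityʳ _)
  *P-distribʳ (a ∷ f) (b ∷ g) h =
    ≋-trans (+P-cong (scale-distribʳ a b h)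
                     (≋-trans (∷-cong refl (*P-distribʳ f g h)) (≋-sym (∷0-+P (f *P h) (g *P h)))))
            (+P-interchange (scale a h) (scale b h) (0# ∷ (f *P h)) (0# ∷ (g *P h)))

  *P-distribˡ : ∀ f g h → (f *P (g +P h)) ≋ ((f *P g) +P (f *P h))
  *P-distribˡ []      g h = ≋-refl
  *P-distribˡ (a ∷ f) g h =
    ≋-trans (+P-cong (scale-distribˡ a g h)
                     (≋-trans (∷-cong refl (*P-distribˡ f g h)) (≋-sym (∷0-+P (f *P g) (f *P h)))))
            (+P-interchange (scale a g) (scale a h) (0# ∷ (f *P g)) (0# ∷ (f *P h)))

  scale-*Pˡ : ∀ a f g → (scale a f *P g) ≋ scale a (f *P g)
  scale-*Pˡ a []      g = ≋-refl
  scale-*Pˡ a (b ∷ f) g =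
    ≋-trans (+P-cong (scale-assoc a b g) (≋-trans (∷-cong refl (scale-*Pˡ a f g)) (≋-sym (scale-∷0 a (f *P g)))))
            (≋-sym (scale-distribˡ a (scale b g) (0# ∷ (f *P g))))

  scale-*Pʳ : ∀ a f g → (f *P scale a g) ≋ scale a (f *P g)
  scale-*Pʳ a []      g = ≋-refl
  scale-*Pʳ a (b ∷ f) g =
    ≋-trans (+P-cong (scale-exchange b a g) (≋-trans (∷-cong refl (scale-*Pʳ a f g)) (≋-sym (scale-∷0 a (f *P g)))))
            (≋-sym (scale-distribˡ a (scale b g) (0# ∷ (f *P g))))

  ∷0-*P : ∀ f h → ((0# ∷ f) *P h) ≋ (0# ∷ (f *P h))
  ∷0-*P f h = +P-≋[]ˡ (scale 0# h) (0# ∷ (f *P h)) (scale-zero h)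

  const-*P : ∀ a g → ((a ∷ []) *P g) ≋ scale a g
  const-*P a g = ≋-trans (+P-congˡ (∷-≋[] refl ≋-refl)) (+P-identityʳ (scale a g))

  *P-∷ : ∀ f b g → (f *P (b ∷ g)) ≋ (scale b f +P (0# ∷ (f *P g)))
  *P-∷ []      b g = ≋-sym (∷-≋[] refl ≋-refl)
  *P-∷ (a ∷ f) b g = ∷-cong (+-congʳ (*-comm a b))
    (≋-trans (+P-congˡ (*P-∷ f b g)) (+P-exchange (scale a g) (scale b f) (0# ∷ (f *P g))))

  *P-comm : ∀ f g → (f *P g) ≋ (g *P f)
  *P-comm []      g = ≋-sym (*P-zeroʳ g)
  *P-comm (a ∷ f) g = ≋-trans (+P-congˡ (∷-cong refl (*P-comm f g))) (≋-sym (*P-∷ g a f))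

  *P-assoc : ∀ f g h → ((f *P g) *P h) ≋ (f *P (g *P h))
  *P-assoc []      g h = ≋-refl
  *P-assoc (a ∷ f) g h =
    ≋-trans (*P-distribʳ (scale a g) (0# ∷ (f *P g)) h)
            (+P-cong (scale-*Pˡ a g h) (≋-trans (∷0-*P (f *P g) h) (∷-cong refl (*P-assoc f g h))))

  ∘P-≋[]ˡ : ∀ f g → f ≋ [] → (f ∘P g) ≋ []
  ∘P-≋[]ˡ []      g e = ≋-refl
  ∘P-≋[]ˡ (a ∷ f) g e =
    ≋-trans (+P-cong (∷-≋[] (at e 0) ≋-refl)
                     (≋-trans (*P-congˡ g (f ∘P g) [] (∘P-≋[]ˡ f g (tail-≋[] e))) (*P-zeroʳ g)))
            (+P-identityʳ [])

  ∘P-congʳ : ∀ f f' g → f ≋ f' → (f ∘P g) ≋ (f' ∘P g)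
  ∘P-congʳ []      []       g e = ≋-refl
  ∘P-congʳ []      (b ∷ f') g e = ≋-sym (∘P-≋[]ˡ (b ∷ f') g (≋-sym e))
  ∘P-congʳ (a ∷ f) []       g e = ∘P-≋[]ˡ (a ∷ f) g e
  ∘P-congʳ (a ∷ f) (b ∷ f') g e =
    +P-cong (∷-cong (at e 0) ≋-refl) (*P-congˡ g _ _ (∘P-congʳ f f' g (tail-≋ e)))

  ∘P-congˡ : ∀ f g g' → g ≋ g' → (f ∘P g) ≋ (f ∘P g')
  ∘P-congˡ []      g g' e = ≋-refl
  ∘P-congˡ (a ∷ f) g g' e = +P-congˡ (*P-cong e (∘P-congˡ f g g' e))

  ∘P-distrib-+P : ∀ f g h → ((f +P g) ∘P h) ≋ ((f ∘P h) +P (g ∘P h))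
  ∘P-distrib-+P []      g       h = ≋-refl
  ∘P-distrib-+P (a ∷ f) []      h = ≋-sym (+P-identityʳ _)
  ∘P-distrib-+P (a ∷ f) (b ∷ g) h =
    ≋-trans (+P-congˡ (≋-trans (*P-congˡ h _ _ (∘P-distrib-+P f g h)) (*P-distribˡ h (f ∘P h) (g ∘P h))))
            (≋-sym (+P-interchange (a ∷ []) (h *P (f ∘P h)) (b ∷ []) (h *P (g ∘P h))))

  ∘P-scale : ∀ a f h → (scale a f ∘P h) ≋ scale a (f ∘P h)
  ∘P-scale a []      h = ≋-refl
  ∘P-scale a (b ∷ f) h =
    ≋-trans (+P-congˡ (≋-trans (*P-congˡ h _ _ (∘P-scale a f h)) (scale-*Pʳ a h (f ∘P h))))
            (≋-sym (scale-distribˡ a (b ∷ []) (h *P (f ∘P h))))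

  ∷0-∘P : ∀ f h → ((0# ∷ f) ∘P h) ≋ (h *P (f ∘P h))
  ∷0-∘P f h = +P-≋[]ˡ (0# ∷ []) _ (∷-≋[] refl ≋-refl)

  const-∘P : ∀ a h → ((a ∷ []) ∘P h) ≋ (a ∷ [])
  const-∘P a h = +P-congˡ (*P-zeroʳ h)

  ∘P-distrib-*P : ∀ f g h → ((f *P g) ∘P h) ≋ ((f ∘P h) *P (g ∘P h))
  ∘P-distrib-*P []      g h = ≋-refl
  ∘P-distrib-*P (a ∷ f) g h = begin
      (scale a g +P (0# ∷ (f *P g))) ∘P h
    ≈⟨ ∘P-distrib-+P (scale a g) (0# ∷ (f *P g)) h ⟩
      (scale a g ∘P h) +P ((0# ∷ (f *P g)) ∘P h)
    ≈⟨ +P-cong (∘P-scale a g h) (≋-trans (∷0-∘P (f *P g) h) (*P-congˡ h _ _ (∘P-distrib-*P f g h))) ⟩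
      scale a (g ∘P h) +P (h *P ((f ∘P h) *P (g ∘P h)))
    ≈⟨ +P-cong (const-*P a (g ∘P h)) (*P-assoc h (f ∘P h) (g ∘P h)) ⟨
      ((a ∷ []) *P (g ∘P h)) +P ((h *P (f ∘P h)) *P (g ∘P h))
    ≈⟨ *P-distribʳ (a ∷ []) (h *P (f ∘P h)) (g ∘P h) ⟨
      ((a ∷ []) +P (h *P (f ∘P h))) *P (g ∘P h)
    ∎
    where open ≋-Reasoning

  ∘P-assoc : ∀ f g h → ((f ∘P g) ∘P h) ≋ (f ∘P (g ∘P h))
  ∘P-assoc []      g h = ≋-refl
  ∘P-assoc (a ∷ f) g h =
    ≋-trans (∘P-distrib-+P (a ∷ []) (g *P (f ∘P g)) h)
            (+P-cong (const-∘P a h) (≋-trans (∘P-distrib-*P g (f ∘P g) h) (*P-congˡ (g ∘P h) _ _ (∘P-assoc f g h))))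

  T-∘P : ∀ f → (Tpol ∘P f) ≋ f
  T-∘P f = begin
      (0# ∷ []) +P (f *P ((1# ∷ []) ∘P f))
    ≈⟨ +P-≋[]ˡ (0# ∷ []) _ (∷-≋[] refl ≋-refl) ⟩
      f *P ((1# ∷ []) ∘P f)
    ≈⟨ *P-congˡ f _ (1# ∷ []) (const-∘P 1# f) ⟩
      f *P (1# ∷ [])
    ≈⟨ *P-∷ f 1# [] ⟩
      scale 1# f +P (0# ∷ (f *P []))
    ≈⟨ +P-cong (scale-identity f) (∷-≋[] refl (*P-zeroʳ f)) ⟩
      f +P []
    ≈⟨ +P-identityʳ f ⟩
      f
    ∎
    where open ≋-Reasoning

  _-P_ : Pol → Pol → Pol
  f -P g = f +P scale (- 1#) g

  coeff--P : ∀ f g i → coeff (f -P g) i ≈ coeff f i - coeff g i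
  coeff--P f g i =
    trans (coeff-+P f (scale (- 1#) g) i) (+-congˡ (trans (coeff-scale (- 1#) g i) (-1*x≈-x _)))

  -P-∘P : ∀ f g h → ((f -P g) ∘P h) ≋ ((f ∘P h) -P (g ∘P h))
  -P-∘P f g h = ≋-trans (∘P-distrib-+P f (scale (- 1#) g) h) (+P-congˡ (∘P-scale (- 1#) g h))

  split : ∀ g g' → g ≋ (g' +P (g -P g'))
  split g g' = mk≋ λ i → sym (trans (coeff-+P g' (g -P g') i) (trans (+-congˡ (coeff--P g g' i))
    (trans (+-comm _ _) (//-rightDividesˡ (coeff g' i) (coeff g i)))))
    where open import Algebra.Properties.Group +-group using (//-rightDividesˡ)

  -- Taylor expansion to first order: f(A + H) = f(A) + Δ A H f · H,
  -- with the difference quotient Δ A H f defined by Horner's scheme.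
  Δ : Pol → Pol → Pol → Pol
  Δ A H []      = []
  Δ A H (a ∷ f) = (A *P Δ A H f) +P (f ∘P (A +P H))

  taylor : ∀ A H f → (f ∘P (A +P H)) ≋ ((f ∘P A) +P (Δ A H f *P H))
  taylor A H []      = ≋-refl
  taylor A H (a ∷ f) = begin
      (a ∷ []) +P ((A +P H) *P X)
    ≈⟨ +P-congˡ {a ∷ []} (≋-trans (*P-distribʳ A H X) (+P-cong (*P-congˡ A _ _ (taylor A H f)) (*P-comm H X))) ⟩
      (a ∷ []) +P ((A *P ((f ∘P A) +P (Δf *P H))) +P (X *P H))
    ≈⟨ +P-congˡ {a ∷ []} (+P-congʳ (≋-trans (*P-distribˡ A (f ∘P A) (Δf *P H)) (+P-congˡ (≋-sym (*P-assoc A Δf H))))) ⟩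
      (a ∷ []) +P (((A *P (f ∘P A)) +P ((A *P Δf) *P H)) +P (X *P H))
    ≈⟨ +P-congˡ {a ∷ []} (+P-assoc (A *P (f ∘P A)) ((A *P Δf) *P H) (X *P H)) ⟩
      (a ∷ []) +P ((A *P (f ∘P A)) +P (((A *P Δf) *P H) +P (X *P H)))
    ≈⟨ +P-assoc (a ∷ []) (A *P (f ∘P A)) (((A *P Δf) *P H) +P (X *P H)) ⟨
      ((a ∷ []) +P (A *P (f ∘P A))) +P (((A *P Δf) *P H) +P (X *P H))
    ≈⟨ +P-congˡ (*P-distribʳ (A *P Δf) X H) ⟨
      ((a ∷ []) +P (A *P (f ∘P A))) +P (((A *P Δf) +P X) *P H)
    ∎
    where
    open ≋-Reasoning
    X  = f ∘P (A +P H)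
    Δf = Δ A H f

  coeff-take-< : ∀ k f i → i < k → coeff (take k f) i P.≡ coeff f i
  coeff-take-< (suc k) []      i       _         = P.refl
  coeff-take-< (suc k) (a ∷ f) zero    _         = P.refl
  coeff-take-< (suc k) (a ∷ f) (suc i) (s≤s i<k) = coeff-take-< k f i i<k

  coeff-take-≥ : ∀ k f i → k ≤ i → coeff (take k f) i P.≡ 0#
  coeff-take-≥ zero    f       i       _         = P.refl
  coeff-take-≥ (suc k) []      i       _         = P.refl
  coeff-take-≥ (suc k) (a ∷ f) (suc i) (s≤s k≤i) = coeff-take-≥ k f i k≤i

  coeff-length : ∀ f i → length f ≤ i → coeff f i P.≡ 0#
  coeff-length []      i       _         = P.refl
  coeff-length (a ∷ f) (suc i) (s≤s l≤i) = coeff-length f i l≤i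

  coeff-T : ∀ i → 2 ≤ i → coeff Tpol i P.≡ 0#
  coeff-T (suc zero)    (s≤s ())
  coeff-T (suc (suc i)) _ = P.refl

module WeightedDivisibility {c ℓ} (R : CommutativeRing c ℓ) (q : CommutativeRing.Carrier R) where
  open CommutativeRing R
  open Poly R
  open Poly.Mod R q
  open Divisibility R
  open Polynomials R
  open Weights using (Weight; horner-bound; above; above-≤1; above-beyond; above-within; above-+)
  open import Algebra.Properties.CommutativeSemigroup *-commutativeSemigroup
    using () renaming (x∙yz≈y∙xz to *-exchange)

  weaken : ∀ {m k x} → m ≤ k → pow q k ∣R x → pow q m ∣R x
  weaken m≤k = ∣-trans (pow-∣ q m≤k)

  pow-∣-* : ∀ {m k x y} → pow q m ∣R x → pow q k ∣R y → pow q (m ℕ.+ k) ∣R (x * y)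
  pow-∣-* {m} {k} d e = ∣-trans (∣-resp (pow-+ q m k) ∣-refl) (∣-* d e)

  record Weighted (w : ℕ → ℕ) (f : Pol) : Set (c ⊔ ℓ) where
    constructor mkW
    field divides : ∀ i → pow q (w i) ∣R coeff f i
  open Weighted public

  Weighted-resp : ∀ {w f g} → f ≋ g → Weighted w f → Weighted w g
  Weighted-resp f≋g W = mkW λ i → ∣-resp (at f≋g i) (divides W i)

  Weighted-0 : ∀ {f} → Weighted (const 0) f
  Weighted-0 = mkW λ _ → 1∣

  Weighted-[] : ∀ {w} → Weighted w []
  Weighted-[] = mkW λ _ → ∣-0

  Weighted-weaken : ∀ {w w' f} → (∀ i → w' i ≤ w i) → Weighted w f → Weighted w' f
  Weighted-weaken w'≤w W = mkW λ i → weaken (w'≤w i) (divides W i)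

  Weighted-∷ : ∀ {w a f} → pow q (w 0) ∣R a → Weighted (λ i → w (suc i)) f → Weighted w (a ∷ f)
  Weighted-∷ d W = mkW λ { zero → d ; (suc i) → divides W i }

  Weighted-tail : ∀ {w a f} → Weighted w (a ∷ f) → Weighted (λ i → w (suc i)) f
  Weighted-tail W = mkW λ i → divides W (suc i)

  Weighted-+P : ∀ {w f g} → Weighted w f → Weighted w g → Weighted w (f +P g)
  Weighted-+P {f = f} {g} Wf Wg = mkW λ i → ∣-resp (sym (coeff-+P f g i)) (∣-+ (divides Wf i) (divides Wg i))

  Weighted-*P : ∀ {u v w} f g → Weighted u f → Weighted v g →
                (∀ i j → w (i ℕ.+ j) ≤ u i ℕ.+ v j) → Weighted w (f *P g)
  Weighted-*P []      g Wf Wg bound = Weighted-[]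
  Weighted-*P {u} {v} {w} (a ∷ f) g Wf Wg bound =
    Weighted-+P (mkW λ i → ∣-resp (sym (coeff-scale a g i))
                              (weaken (bound 0 i) (pow-∣-* {u 0} {v i} (divides Wf 0) (divides Wg i))))
                (Weighted-∷ ∣-0 (Weighted-*P f g (Weighted-tail Wf) Wg (λ i j → bound (suc i) j)))

  Weighted-∘P-const : ∀ k f g → Weighted (const k) f → Weighted (const k) (f ∘P g)
  Weighted-∘P-const k []      g W = Weighted-[]
  Weighted-∘P-const k (a ∷ f) g W =
    Weighted-+P (Weighted-∷ (divides W 0) Weighted-[])
                (Weighted-*P g (f ∘P g) Weighted-0 (Weighted-∘P-const k f g (Weighted-tail W)) (λ _ _ → ℕₚ.≤-refl))

  -- The central estimate: for a weight w, composition preserves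
  -- w-divisibility. The shift s tracks the Horner recursion.
  Weighted-∘P-shifted : ∀ {w} → Weight w → ∀ s f g →
    Weighted (λ k → w (s ℕ.+ k)) f → Weighted w g → Weighted (λ k → w (s ℕ.+ k)) (f ∘P g)
  Weighted-∘P-shifted W s []      g Wf Wg = Weighted-[]
  Weighted-∘P-shifted {w} W s (a ∷ f) g Wf Wg =
    Weighted-+P (Weighted-∷ (divides Wf 0) Weighted-[])
      (Weighted-*P g (f ∘P g) Wg
        (Weighted-∘P-shifted W (suc s) f g
          (Weighted-weaken (λ i → ℕₚ.≤-reflexive (P.cong w (P.sym (ℕₚ.+-suc s i)))) (Weighted-tail Wf)) Wg)
        (horner-bound W s))

  Weighted-∘P : ∀ {w} → Weight w → ∀ f g → Weighted w f → Weighted w g → Weighted w (f ∘P g)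
  Weighted-∘P W = Weighted-∘P-shifted W 0

  -- Congruence modulo q^m, i.e. f ≡[ m ] g, packaged so that f and g are inferable.
  infix 4 _≈[_]_
  record _≈[_]_ (f : Pol) (m : ℕ) (g : Pol) : Set (c ⊔ ℓ) where
    constructor mk≈
    field coeff-mod : f ≡[ m ] g
  open _≈[_]_ public

  ≋⇒≈ : ∀ {m f g} → f ≋ g → f ≈[ m ] g
  ≋⇒≈ f≋g = mk≈ λ i → mod-reflexive (at f≋g i)

  ≈-sym : ∀ {m f g} → f ≈[ m ] g → g ≈[ m ] f
  ≈-sym e = mk≈ λ i → mod-sym (coeff-mod e i)

  ≈-trans : ∀ {m f g h} → f ≈[ m ] g → g ≈[ m ] h → f ≈[ m ] h
  ≈-trans e e' = mk≈ λ i → mod-trans (coeff-mod e i) (coeff-mod e' i)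

  ≈-weaken : ∀ {m k f g} → m ≤ k → f ≈[ k ] g → f ≈[ m ] g
  ≈-weaken m≤k e = mk≈ λ i → weaken m≤k (coeff-mod e i)

  ≈-setoid : ℕ → Setoid c (c ⊔ ℓ)
  ≈-setoid m = record
    { Carrier = Pol ; _≈_ = _≈[ m ]_
    ; isEquivalence = record { refl = ≋⇒≈ ≋-refl ; sym = ≈-sym ; trans = ≈-trans } }

  module ≈-Reasoning (m : ℕ) = Relation.Binary.Reasoning.Setoid (≈-setoid m)

  ≈⇒Weighted : ∀ {m f g} → f ≈[ m ] g → Weighted (const m) (f -P g)
  ≈⇒Weighted {f = f} {g} e = mkW λ i → ∣-resp (sym (coeff--P f g i)) (coeff-mod e i)

  Weighted⇒≈ : ∀ {m f g} → Weighted (const m) (f -P g) → f ≈[ m ] g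
  Weighted⇒≈ {f = f} {g} W = mk≈ λ i → ∣-resp (coeff--P f g i) (divides W i)

  drop-summand : ∀ {m F G H} → F ≋ (G +P H) → Weighted (const m) H → F ≈[ m ] G
  drop-summand {G = G} {H} F≋G+H W = mk≈ λ i →
    mod-trans (mod-reflexive (trans (at F≋G+H i) (coeff-+P G H i)))
              (mod-trans (mod-+ (mod-reflexive refl) (mod-zero (divides W i))) (mod-reflexive (+-identityʳ _)))

  ∘P-congʳ-mod : ∀ {m f f'} g → f ≈[ m ] f' → (f ∘P g) ≈[ m ] (f' ∘P g)
  ∘P-congʳ-mod {m} {f} {f'} g e =
    Weighted⇒≈ (Weighted-resp (-P-∘P f f' g) (Weighted-∘P-const m (f -P f') g (≈⇒Weighted e)))

  ∘P-congˡ-mod : ∀ {m g g'} f → g ≈[ m ] g' → (f ∘P g) ≈[ m ] (f ∘P g')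
  ∘P-congˡ-mod {m} {g} {g'} f e =
    drop-summand (≋-trans (∘P-congˡ f _ _ (split g g')) (taylor g' (g -P g') f))
                 (Weighted-*P (Δ g' (g -P g') f) (g -P g') Weighted-0 (≈⇒Weighted e) (λ _ _ → ℕₚ.≤-refl))

  beyond-degree : ∀ {D f i} → Weighted (above D) f → D < i → pow q 1 ∣R coeff f i
  beyond-degree {D} {f} {i} W D<i = P.subst (λ e → pow q e ∣R coeff f i) (above-beyond D<i) (divides W i)

  degree-bound : ∀ D f → (∀ i → D < i → pow q 1 ∣R coeff f i) → Weighted (above D) f
  degree-bound D f beyond = mkW coefficient
    where
    coefficient : ∀ i → pow q (above D i) ∣R coeff f i
    coefficient i with D ℕ.<? i
    ... | yes D<i = P.subst (λ e → pow q e ∣R coeff f i) (P.sym (above-beyond D<i)) (beyond i D<i)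
    ... | no  D≮i = P.subst (λ e → pow q e ∣R coeff f i) (P.sym (above-within (ℕₚ.≮⇒≥ D≮i))) 1∣

  Weighted-length : ∀ f → Weighted (above (length f)) f
  Weighted-length f = degree-bound (length f) f λ i l<i →
    P.subst (pow q 1 ∣R_) (P.sym (coeff-length f i (ℕₚ.<⇒≤ l<i))) ∣-0

  lower-degree : ∀ D f → Weighted (above (suc D)) f → pow q 1 ∣R coeff f (suc D) → Weighted (above D) f
  lower-degree D f W d = degree-bound D f beyond
    where
    beyond : ∀ i → D < i → pow q 1 ∣R coeff f i
    beyond i D<i with ℕₚ.m≤n⇒m<n∨m≡n D<i
    ... | inj₁ 1+D<i  = beyond-degree W 1+D<i
    ... | inj₂ P.refl = d

  Weighted-∘P-above : ∀ a b f g → Weighted (above a) f → Weighted (above b) g → Weighted (above (a ℕ.* b)) (f ∘P g)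
  Weighted-∘P-above a       b []      g Wf Wg = Weighted-[]
  Weighted-∘P-above zero    b (x ∷ f) g Wf Wg =
    Weighted-+P (Weighted-∷ 1∣ Weighted-[])
      (Weighted-*P g (f ∘P g) Weighted-0 (Weighted-∘P-const 1 f g (Weighted-tail Wf)) (λ i j → above-≤1 0 (i ℕ.+ j)))
  Weighted-∘P-above (suc a) b (x ∷ f) g Wf Wg =
    Weighted-+P (Weighted-∷ 1∣ Weighted-[])
      (Weighted-*P g (f ∘P g) Wg (Weighted-∘P-above a b f g (Weighted-tail Wf) Wg) (above-+ b (a ℕ.* b)))

  top-*P : ∀ a b f g → Weighted (above a) f → Weighted (above b) g →
           coeff (f *P g) (a ℕ.+ b) ≡ coeff f a * coeff g b mod pow q 1
  top-*P a b [] g _ _ = mod-reflexive (sym (zeroˡ _))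
  top-*P zero b (x ∷ f) g Wf Wg = begin
      coeff (scale x g +P (0# ∷ (f *P g))) b
    ≈⟨ mod-reflexive (coeff-+P (scale x g) (0# ∷ (f *P g)) b) ⟩
      coeff (scale x g) b + coeff (0# ∷ (f *P g)) b
    ≈⟨ mod-+ (mod-reflexive (coeff-scale x g b)) (mod-zero (divides rest b)) ⟩
      x * coeff g b + 0#
    ≈⟨ mod-reflexive (+-identityʳ _) ⟩
      x * coeff g b
    ∎
    where
    open mod-Reasoning (pow q 1)
    rest : Weighted (const 1) (0# ∷ (f *P g))
    rest = Weighted-∷ ∣-0 (Weighted-*P f g (Weighted-tail Wf) Weighted-0 (λ _ _ → ℕₚ.≤-refl))
  top-*P (suc a) b (x ∷ f) g Wf Wg = begin
      coeff (scale x g +P (0# ∷ (f *P g))) (suc (a ℕ.+ b))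
    ≈⟨ mod-reflexive (coeff-+P (scale x g) (0# ∷ (f *P g)) (suc (a ℕ.+ b))) ⟩
      coeff (scale x g) (suc (a ℕ.+ b)) + coeff (f *P g) (a ℕ.+ b)
    ≈⟨ mod-+ high (top-*P a b f g (Weighted-tail Wf) Wg) ⟩
      0# + coeff f a * coeff g b
    ≈⟨ mod-reflexive (+-identityˡ _) ⟩
      coeff f a * coeff g b
    ∎
    where
    open mod-Reasoning (pow q 1)
    high : coeff (scale x g) (suc (a ℕ.+ b)) ≡ 0# mod pow q 1
    high = mod-zero (∣-resp (sym (coeff-scale x g _)) (∣-*ˡ x (beyond-degree Wg (s≤s (ℕₚ.m≤n+m b a)))))

  top-∘P : ∀ a b f g → Weighted (above a) f → Weighted (above (suc b)) g →
           coeff (f ∘P g) (a ℕ.* suc b) ≡ coeff f a * pow (coeff g (suc b)) a mod pow q 1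
  top-∘P a b [] g _ _ = mod-reflexive (sym (zeroˡ _))
  top-∘P zero b (x ∷ f) g Wf Wg = begin
      coeff ((x ∷ []) +P (g *P (f ∘P g))) 0
    ≈⟨ mod-reflexive (coeff-+P (x ∷ []) (g *P (f ∘P g)) 0) ⟩
      x + coeff (g *P (f ∘P g)) 0
    ≈⟨ mod-+ (mod-reflexive (sym (*-identityʳ x))) (mod-zero (divides rest 0)) ⟩
      x * 1# + 0#
    ≈⟨ mod-reflexive (+-identityʳ _) ⟩
      x * 1#
    ∎
    where
    open mod-Reasoning (pow q 1)
    rest : Weighted (const 1) (g *P (f ∘P g))
    rest = Weighted-*P g (f ∘P g) Weighted-0 (Weighted-∘P-const 1 f g (Weighted-tail Wf)) (λ _ _ → ℕₚ.≤-refl)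
  top-∘P (suc a) b (x ∷ f) g Wf Wg = begin
      coeff ((x ∷ []) +P (g *P (f ∘P g))) (suc b ℕ.+ a ℕ.* suc b)
    ≈⟨ mod-reflexive (trans (coeff-+P (x ∷ []) (g *P (f ∘P g)) _) (+-identityˡ _)) ⟩
      coeff (g *P (f ∘P g)) (suc b ℕ.+ a ℕ.* suc b)
    ≈⟨ top-*P (suc b) (a ℕ.* suc b) g (f ∘P g) Wg (Weighted-∘P-above a (suc b) f g (Weighted-tail Wf) Wg) ⟩
      gb * coeff (f ∘P g) (a ℕ.* suc b)
    ≈⟨ mod-*ˡ gb (top-∘P a b f g (Weighted-tail Wf) Wg) ⟩
      gb * (coeff f a * pow gb a)
    ≈⟨ mod-reflexive (*-exchange gb (coeff f a) (pow gb a)) ⟩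
      coeff f a * (gb * pow gb a)
    ∎
    where
    open mod-Reasoning (pow q 1)
    gb = coeff g (suc b)

  ≈T-high : ∀ {m f i} → f ≈[ m ] Tpol → 2 ≤ i → pow q m ∣R coeff f i
  ≈T-high {m} {f} {i} e 2≤i = mod-∣ (coeff-mod e i) (P.subst (pow q m ∣R_) (P.sym (coeff-T i 2≤i)) ∣-0)

  Weighted-Δ : ∀ A H x f → Weighted (const 1) f → Weighted (const 1) (Δ A H (x ∷ f))
  Weighted-Δ A H x []      W = Weighted-+P (Weighted-*P A [] Weighted-0 Weighted-[] (λ _ _ → ℕₚ.≤-refl)) Weighted-[]
  Weighted-Δ A H x (y ∷ f) W =
    Weighted-+P (Weighted-*P A (Δ A H (y ∷ f)) Weighted-0 (Weighted-Δ A H y f (Weighted-tail W)) (λ _ _ → ℕₚ.≤-refl))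
                (Weighted-∘P-const 1 (y ∷ f) (A +P H) W)

  Δ-linear : ∀ A H ψ → Weighted (above 1) ψ → Δ A H ψ ≈[ 1 ] (coeff ψ 1 ∷ [])
  Δ-linear A H []              W = ≋⇒≈ (≋-sym (∷-≋[] refl ≋-refl))
  Δ-linear A H (x₀ ∷ [])       W = ≋⇒≈ (≋-trans (+P-congʳ (*P-zeroʳ A)) (≋-sym (∷-≋[] refl ≋-refl)))
  Δ-linear A H (x₀ ∷ x₁ ∷ ψ) W =
    drop-summand (+P-exchange (A *P Δ A H (x₁ ∷ ψ)) (x₁ ∷ []) ((A +P H) *P (ψ ∘P (A +P H))))
      (Weighted-+P (Weighted-*P A (Δ A H (x₁ ∷ ψ)) Weighted-0 (Weighted-Δ A H x₁ ψ Wψ) (λ _ _ → ℕₚ.≤-refl))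
                   (Weighted-*P (A +P H) (ψ ∘P (A +P H)) Weighted-0 (Weighted-∘P-const 1 ψ (A +P H) Wψ) (λ _ _ → ℕₚ.≤-refl)))
    where
    Wψ : Weighted (const 1) ψ
    Wψ = Weighted-tail (Weighted-tail W)

  first-order : ∀ m A H ψ → Weighted (above 1) ψ → Weighted (const m) H →
                (ψ ∘P (A +P H)) ≈[ suc m ] ((ψ ∘P A) +P scale (coeff ψ 1) H)
  first-order m A H ψ Wψ WH = drop-summand expansion (Weighted-*P E H (≈⇒Weighted (Δ-linear A H ψ Wψ)) WH (λ _ _ → ℕₚ.≤-refl))
    where
    open ≋-Reasoning
    b = coeff ψ 1
    E = Δ A H ψ -P (b ∷ [])
    expansion : (ψ ∘P (A +P H)) ≋ (((ψ ∘P A) +P scale b H) +P (E *P H))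
    expansion = begin
        ψ ∘P (A +P H)
      ≈⟨ taylor A H ψ ⟩
        (ψ ∘P A) +P (Δ A H ψ *P H)
      ≈⟨ +P-congˡ (*P-congʳ (Δ A H ψ) _ H (split (Δ A H ψ) (b ∷ []))) ⟩
        (ψ ∘P A) +P (((b ∷ []) +P E) *P H)
      ≈⟨ +P-congˡ (≋-trans (*P-distribʳ (b ∷ []) E H) (+P-congʳ (const-*P b H))) ⟩
        (ψ ∘P A) +P (scale b H +P (E *P H))
      ≈⟨ +P-assoc (ψ ∘P A) (scale b H) (E *P H) ⟨
        ((ψ ∘P A) +P scale b H) +P (E *P H)
      ∎

module Automorphisms {c ℓ} (R : CommutativeRing c ℓ) (q : CommutativeRing.Carrier R) (n : ℕ) where
  open Poly R
  open Poly.Mod R q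
  open Polynomials R
  open WeightedDivisibility R q

  left-inverse : ∀ f g → InvMod n f g → (f ∘P g) ≈[ n ] Tpol
  left-inverse f g (fg≡T , _) = mk≈ fg≡T

  right-inverse : ∀ f g → InvMod n f g → (g ∘P f) ≈[ n ] Tpol
  right-inverse f g (_ , gf≡T) = mk≈ gf≡T

  inverse : ∀ f g → (f ∘P g) ≈[ n ] Tpol → (g ∘P f) ≈[ n ] Tpol → InvMod n f g
  inverse f g fg≈T gf≈T = coeff-mod fg≈T , coeff-mod gf≈T

  inverse-resp : ∀ f f' g → f ≡[ n ] f' → InvMod n f g → InvMod n f' g
  inverse-resp f f' g f≡f' f⁻¹=g =
    inverse f' g (≈-trans (∘P-congʳ-mod g f'≈f) (left-inverse f g f⁻¹=g))
                 (≈-trans (∘P-congˡ-mod g f'≈f) (right-inverse f g f⁻¹=g))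
    where
    f'≈f : f' ≈[ n ] f
    f'≈f = ≈-sym (mk≈ f≡f')

  inverse-T : InvMod n Tpol Tpol
  inverse-T = inverse Tpol Tpol (≋⇒≈ (T-∘P Tpol)) (≋⇒≈ (T-∘P Tpol))

  cancel-middle : ∀ f f' g g' → (f ∘P f') ≈[ n ] Tpol → (g ∘P g') ≈[ n ] Tpol →
                  ((f ∘P g) ∘P (g' ∘P f')) ≈[ n ] Tpol
  cancel-middle f f' g g' ff'≈T gg'≈T = begin
      (f ∘P g) ∘P (g' ∘P f')   ≈⟨ ≋⇒≈ (≋-trans (∘P-assoc f g (g' ∘P f')) (∘P-congˡ f _ _ (≋-sym (∘P-assoc g g' f')))) ⟩
      f ∘P ((g ∘P g') ∘P f')   ≈⟨ ∘P-congˡ-mod f (∘P-congʳ-mod f' gg'≈T) ⟩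
      f ∘P (Tpol ∘P f')        ≈⟨ ≋⇒≈ (∘P-congˡ f _ _ (T-∘P f')) ⟩
      f ∘P f'                  ≈⟨ ff'≈T ⟩
      Tpol                     ∎
    where open ≈-Reasoning n

  inverse-∘P : ∀ f f' g g' → InvMod n f f' → InvMod n g g' → InvMod n (f ∘P g) (g' ∘P f')
  inverse-∘P f f' g g' f⁻¹=f' g⁻¹=g' =
    inverse (f ∘P g) (g' ∘P f') (cancel-middle f f' g g' (left-inverse f f' f⁻¹=f') (left-inverse g g' g⁻¹=g'))
                                (cancel-middle g' g f' f (right-inverse g g' g⁻¹=g') (right-inverse f f' f⁻¹=f'))

module PrimeElement {c ℓ} (R : CommutativeRing c ℓ) (q : CommutativeRing.Carrier R)
                    (torsion-free : Poly.TorsionFree R q) (prime : Poly.PrimePrincipal R q) where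
  open CommutativeRing R
  open Poly R
  open Divisibility R
  open WeightedDivisibility R q
  open Weights using (above; above-antitone)
  open import Relation.Binary.Reasoning.Setoid setoid
  open import Algebra.Properties.Ring ring using (x[y-z]≈xy-xz)
  open import Algebra.Properties.CommutativeSemigroup *-commutativeSemigroup
    using () renaming (x∙yz≈y∙xz to *-exchange)

  q∤1 : ¬ q ∣R 1#
  q∤1 = proj₁ prime

  q-prime : ∀ a b → q ∣R (a * b) → q ∣R a ⊎ q ∣R b
  q-prime = proj₂ prime

  -- q and q¹ = q · 1 divide the same elements.
  pow1⇒q : ∀ {x} → pow q 1 ∣R x → q ∣R x
  pow1⇒q = ∣-trans (1# , refl)

  q⇒pow1 : ∀ {x} → q ∣R x → pow q 1 ∣R x
  q⇒pow1 = ∣-trans (1# , sym (trans (*-identityʳ _) (*-identityʳ q)))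

  q∣pow : ∀ x k → q ∣R pow x k → q ∣R x
  q∣pow x zero    q∣1 = contradiction q∣1 q∤1
  q∣pow x (suc k) q∣xxᵏ with q-prime x (pow x k) q∣xxᵏ
  ... | inj₁ q∣x  = q∣x
  ... | inj₂ q∣xᵏ = q∣pow x k q∣xᵏ

  cancel-q : ∀ {x y} → q * x ≈ q * y → x ≈ y
  cancel-q {x} {y} qx≈qy = x∙y⁻¹≈ε⇒x≈y x y (torsion-free (x - y)
    (trans (x[y-z]≈xy-xz q x y) (x≈y⇒x∙y⁻¹≈ε qx≈qy)))
    where open import Algebra.Properties.Group +-group using (x∙y⁻¹≈ε⇒x≈y; x≈y⇒x∙y⁻¹≈ε)

  cancel-pow : ∀ k {x y} → pow q k * x ≈ pow q k * y → x ≈ y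
  cancel-pow zero    {x} {y} e = trans (sym (*-identityˡ x)) (trans e (*-identityˡ y))
  cancel-pow (suc k) {x} {y} e = cancel-pow k (cancel-q (trans (sym (*-assoc q _ x)) (trans e (*-assoc q _ y))))

  divide-further : ∀ m {b x} → ¬ q ∣R b → pow q m ∣R x → pow q (suc m) ∣R (b * x) → pow q (suc m) ∣R x
  divide-further m {b} {x} q∤b (y , x≈qᵐy) (z , bx≈qᵐ⁺¹z) with q-prime b y (z , by≈qz)
    where
    by≈qz : b * y ≈ q * z
    by≈qz = cancel-pow m (begin
      pow q m * (b * y)    ≈⟨ *-exchange (pow q m) b y ⟩
      b * (pow q m * y)    ≈⟨ *-congˡ x≈qᵐy ⟨
      b * x                ≈⟨ bx≈qᵐ⁺¹z ⟩
      (q * pow q m) * z    ≈⟨ *-assoc q (pow q m) z ⟩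
      q * (pow q m * z)    ≈⟨ *-exchange q (pow q m) z ⟩
      pow q m * (q * z)    ∎)
  ... | inj₁ q∣b          = contradiction q∣b q∤b
  ... | inj₂ (w , y≈qw) = w , (begin
      x                    ≈⟨ x≈qᵐy ⟩
      pow q m * y          ≈⟨ *-congˡ y≈qw ⟩
      pow q m * (q * w)    ≈⟨ *-exchange (pow q m) q w ⟩
      q * (pow q m * w)    ≈⟨ *-assoc q (pow q m) w ⟨
      (q * pow q m) * w    ∎)

  -- If deg f ≤ a+2 and deg g ≤ b+1 modulo q while f ∘ g ≡ T, the leading
  -- coefficient f_(a+2) g_(b+1)^(a+2) of f ∘ g sits in degree ≥ 2, so q divides it.
  leading-vanishes : ∀ a b f g → Weighted (above (suc (suc a))) f → Weighted (above (suc b)) g →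
                     (f ∘P g) ≈[ 1 ] Tpol → pow q 1 ∣R (coeff f (suc (suc a)) * pow (coeff g (suc b)) (suc (suc a)))
  leading-vanishes a b f g Wf Wg fg≈T = mod-∣ (mod-sym (top-∘P (suc (suc a)) b f g Wf Wg)) (≈T-high fg≈T 2≤deg)
    where
    2≤deg : 2 ≤ suc (suc a) ℕ.* suc b
    2≤deg = ℕₚ.*-mono-≤ {2} {suc (suc a)} {1} {suc b} (s≤s (s≤s z≤n)) (s≤s z≤n)

  -- Automorphisms modulo q are linear modulo q: starting from any degree
  -- bounds a, b for f, g, primality lets one of them be lowered until a ≤ 1;
  -- b = 0 is impossible since then f ∘ g would be constant modulo q.
  linear-mod-q : ∀ a b f g → Weighted (above a) f → Weighted (above b) g → (f ∘P g) ≈[ 1 ] Tpol → Weighted (above 1) f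
  linear-mod-q zero          b       f g Wf Wg fg≈T = Weighted-weaken (λ i → above-antitone i z≤n) Wf
  linear-mod-q (suc zero)    b       f g Wf Wg fg≈T = Wf
  linear-mod-q (suc (suc a)) zero    f g Wf Wg fg≈T = contradiction (pow1⇒q q∣1) q∤1
    where
    -- g constant modulo q makes f ∘ g constant, but its linear coefficient is 1.
    constant : Weighted (above 0) (f ∘P g)
    constant = P.subst (λ D → Weighted (above D) (f ∘P g)) (ℕₚ.*-zeroʳ (suc (suc a)))
                       (Weighted-∘P-above (suc (suc a)) 0 f g Wf Wg)
    q∣1 : pow q 1 ∣R 1#
    q∣1 = mod-∣ (mod-sym (coeff-mod fg≈T 1)) (beyond-degree constant (s≤s z≤n))
  linear-mod-q (suc (suc a)) (suc b) f g Wf Wg fg≈T =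
    [ (λ q∣f-lead → linear-mod-q (suc a) (suc b) f g (lower-degree (suc a) f Wf (q⇒pow1 q∣f-lead)) Wg fg≈T)
    , (λ q∣g-leadᵏ → linear-mod-q (suc (suc a)) b f g Wf
                       (lower-degree b g Wg (q⇒pow1 (q∣pow _ (suc (suc a)) q∣g-leadᵏ))) fg≈T)
    ]′ (q-prime _ _ (pow1⇒q (leading-vanishes a b f g Wf Wg fg≈T)))

  automorphism-linear : ∀ f g → (f ∘P g) ≈[ 1 ] Tpol → Weighted (above 1) f
  automorphism-linear f g = linear-mod-q (length f) (length g) f g (Weighted-length f) (Weighted-length g)

  -- The linear coefficient of an automorphism is a unit modulo q:
  -- 1 ≡ (f ∘ g)₁ ≡ f₁ g₁ modulo q.
  linear-coefficient-unit : ∀ f g → (f ∘P g) ≈[ 1 ] Tpol → (g ∘P f) ≈[ 1 ] Tpol → ¬ q ∣R coeff f 1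
  linear-coefficient-unit f g fg≈T gf≈T q∣f₁ = q∤1 (pow1⇒q q∣1)
    where
    q∣1 : pow q 1 ∣R 1#
    q∣1 = mod-∣ (mod-sym (coeff-mod fg≈T 1))
            (mod-∣ (top-∘P 1 0 f g (automorphism-linear f g fg≈T) (automorphism-linear g f gf≈T))
                   (∣-*ʳ _ (q⇒pow1 q∣f₁)))

module AtildeSubgroup {c ℓ} (R : CommutativeRing c ℓ) (q : CommutativeRing.Carrier R)
                      (torsion-free : Poly.TorsionFree R q) (prime : Poly.PrimePrincipal R q)
                      (d : ℕ) (1≤d : 1 ≤ d) (n : ℕ) (2≤n : 2 ≤ n) where
  open CommutativeRing R
  open Poly R
  open Poly.Mod R q
  open Divisibility R
  open Polynomials R
  open WeightedDivisibility R q
  open Weights using (above)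
  open Weights.Threshold d 1≤d
  open Automorphisms R q n
  open PrimeElement R q torsion-free prime

  1≤n : 1 ≤ n
  1≤n = ℕₚ.≤-trans (s≤s z≤n) 2≤n

  DegreeBounds : Pol → Set (c ⊔ ℓ)
  DegreeBounds f = ∀ m → 2 ≤ m → m ≤ n → DegLe m (2 ℕ.^ (m ℕ.∸ 2) ℕ.* d) f

  bounds⇒Weighted : ∀ f → Weighted (above 1) f → DegreeBounds f → Weighted (wt n) f
  bounds⇒Weighted f linear bounds = mkW λ i → level (wt n i) (wt-≤ n i) (wt-< n i)
    where
    level : ∀ {i} m → m ≤ n → (1 ≤ m → th m < i) → pow q m ∣R coeff f i
    level zero                _   _    = 1∣
    level (suc zero)          _   th<i = beyond-degree linear (th<i ℕₚ.≤-refl)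
    level {i} (suc (suc k)) m≤n th<i = bounds (suc (suc k)) (s≤s (s≤s z≤n)) m≤n i (th<i (s≤s z≤n))

  Weighted⇒bounds : ∀ f → Weighted (wt n) f → DegreeBounds f
  Weighted⇒bounds f W (suc zero)    (s≤s ())
  Weighted⇒bounds f W (suc (suc k)) _ m≤n i th<i =
    weaken (wt-greatest n i (suc (suc k)) (s≤s z≤n) m≤n th<i) (divides W i)

  Atilde⇒Weighted : ∀ f → Atilde d n f → Weighted (wt n) f
  Atilde⇒Weighted f ((f' , f⁻¹=f') , bounds) =
    bounds⇒Weighted f (automorphism-linear f f' (≈-weaken 1≤n (left-inverse f f' f⁻¹=f'))) bounds

  module InverseBounds (ψ g : Pol) (Wψ : Weighted (wt n) ψ) (ψ⁻¹=g : InvMod n ψ g) where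
    b : Carrier
    b = coeff ψ 1

    q∤b : ¬ q ∣R b
    q∤b = linear-coefficient-unit ψ g (≈-weaken 1≤n (left-inverse ψ g ψ⁻¹=g)) (≈-weaken 1≤n (right-inverse ψ g ψ⁻¹=g))

    ψ-linear : Weighted (above 1) ψ
    ψ-linear = automorphism-linear ψ g (≈-weaken 1≤n (left-inverse ψ g ψ⁻¹=g))

    -- From level m to level m+1: split g = g̃ + H at degree t = th (m+1).
    -- Then H ≡ 0 modulo q^m, and ψ(g) ≡ ψ(g̃) + b H modulo q^(m+1) by the
    -- first-order expansion. Beyond degree t both ψ(g) ≡ T and ψ(g̃) vanish
    -- modulo q^(m+1), hence so does b H, and q ∤ b gives H ≡ 0 there.
    module Step (m : ℕ) (m<n : m < n) (Wg : Weighted (wt m) g) where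
      t : ℕ
      t = th (suc m)

      g̃ H : Pol
      g̃ = take (suc t) g
      H = g -P g̃

      -- Indices beyond t are at least 2, where T has no coefficients.
      2≤beyond : ∀ {i} → t < i → 2 ≤ i
      2≤beyond t<i = ℕₚ.≤-trans (s≤s (th-positive (suc m) (s≤s z≤n))) t<i

      -- g̃ already satisfies the level-(m+1) bounds: it vanishes beyond t,
      -- and up to t the weights at levels m and m+1 agree.
      truncation-weighted : Weighted (wt (suc m)) g̃
      truncation-weighted = mkW coefficient
        where
        coefficient : ∀ i → pow q (wt (suc m) i) ∣R coeff g̃ i
        coefficient i with i ℕ.≤? t
        ... | yes i≤t = P.subst₂ (λ e x → pow q e ∣R x) (P.sym (wt-not-top m i (ℕₚ.≤⇒≯ i≤t)))
                                 (P.sym (coeff-take-< (suc t) g i (s≤s i≤t))) (divides Wg i)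
        ... | no  i≰t = P.subst (pow q (wt (suc m) i) ∣R_) (P.sym (coeff-take-≥ (suc t) g i (ℕₚ.≰⇒> i≰t))) ∣-0

      H-beyond : ∀ i → t < i → coeff H i ≈ coeff g i
      H-beyond i t<i = trans (coeff--P g g̃ i)
        (P.subst (λ x → coeff g i - x ≈ coeff g i) (P.sym (coeff-take-≥ (suc t) g i t<i)) (x-0≈x (coeff g i)))

      remainder-weighted : Weighted (const m) H
      remainder-weighted = mkW coefficient
        where
        coefficient : ∀ i → pow q m ∣R coeff H i
        coefficient i with i ℕ.≤? t
        ... | yes i≤t = ∣-resp (sym (coeff--P g g̃ i))
                          (mod-reflexive (reflexive (P.sym (coeff-take-< (suc t) g i (s≤s i≤t)))))
        ... | no  i≰t = ∣-resp (sym (H-beyond i t<i)) (weaken (wt-reaches m i t<i) (divides Wg i))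
          where t<i = ℕₚ.≰⇒> i≰t

      expansion : (ψ ∘P g) ≈[ suc m ] ((ψ ∘P g̃) +P scale b H)
      expansion = ≈-trans (≋⇒≈ (∘P-congˡ ψ _ _ (split g g̃))) (first-order m g̃ H ψ ψ-linear remainder-weighted)

      high : ∀ i → t < i → pow q (suc m) ∣R coeff g i
      high i t<i = ∣-resp (H-beyond i t<i) (divide-further m q∤b (divides remainder-weighted i) bH-divisible)
        where
        ψg-high : pow q (suc m) ∣R coeff (ψ ∘P g) i
        ψg-high = ≈T-high (≈-weaken m<n (left-inverse ψ g ψ⁻¹=g)) (2≤beyond t<i)

        ψg̃-high : pow q (suc m) ∣R coeff (ψ ∘P g̃) i
        ψg̃-high = P.subst (λ e → pow q e ∣R coeff (ψ ∘P g̃) i) (wt-top m i t<i)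
          (divides (Weighted-∘P (weight (suc m)) ψ g̃
                      (Weighted-weaken (λ j → wt-level-monotone j m<n) Wψ) truncation-weighted) i)

        bH-divisible : pow q (suc m) ∣R (b * coeff H i)
        bH-divisible = mod-∣ (begin
            b * coeff H i                                ≈⟨ mod-reflexive (sym (+-identityˡ _)) ⟩
            0# + b * coeff H i                           ≈⟨ mod-+ (mod-sym (mod-zero ψg̃-high)) (mod-reflexive (sym (coeff-scale b H i))) ⟩
            coeff (ψ ∘P g̃) i + coeff (scale b H) i      ≈⟨ mod-reflexive (sym (coeff-+P (ψ ∘P g̃) (scale b H) i)) ⟩
            coeff ((ψ ∘P g̃) +P scale b H) i             ≈⟨ mod-sym (coeff-mod expansion i) ⟩
            coeff (ψ ∘P g) i                             ≈⟨ mod-zero ψg-high ⟩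
            0#                                           ∎) ∣-0
          where open mod-Reasoning (pow q (suc m))

      Weighted-next : Weighted (wt (suc m)) g
      Weighted-next = mkW coefficient
        where
        coefficient : ∀ i → pow q (wt (suc m) i) ∣R coeff g i
        coefficient i with i ℕ.≤? t
        ... | yes i≤t = P.subst (λ e → pow q e ∣R coeff g i) (P.sym (wt-not-top m i (ℕₚ.≤⇒≯ i≤t))) (divides Wg i)
        ... | no  i≰t = P.subst (λ e → pow q e ∣R coeff g i) (P.sym (wt-top m i (ℕₚ.≰⇒> i≰t))) (high i (ℕₚ.≰⇒> i≰t))

    Weighted-inverse : ∀ m → m ≤ n → Weighted (wt m) g
    Weighted-inverse zero    _   = Weighted-0
    Weighted-inverse (suc m) m<n = Step.Weighted-next m m<n (Weighted-inverse m (ℕₚ.<⇒≤ m<n))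

  Atilde-resp : ∀ f g → f ≡[ n ] g → Atilde d n f → Atilde d n g
  Atilde-resp f g f≡g ((f' , f⁻¹=f') , bounds) =
    (f' , inverse-resp f g f' f≡g f⁻¹=f') ,
    λ m 2≤m m≤n i D<i → mod-∣ (mod-coarser (pow-∣ q m≤n) (mod-sym (f≡g i))) (bounds m 2≤m m≤n i D<i)

  T∈Atilde : Atilde d n Tpol
  T∈Atilde = (Tpol , inverse-T) , Weighted⇒bounds Tpol Weighted-T
    where
    -- T has no coefficients beyond degree 1, where wt n vanishes.
    Weighted-T : Weighted (wt n) Tpol
    Weighted-T = mkW λ
      { zero          → ∣-0
      ; (suc zero)    → P.subst (λ e → pow q e ∣R 1#) (P.sym (wt-small n 1 ℕₚ.≤-refl)) 1∣
      ; (suc (suc i)) → ∣-0 }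

  Atilde-∘P : ∀ f g → Atilde d n f → Atilde d n g → Atilde d n (f ∘P g)
  Atilde-∘P f g Af@((f' , f⁻¹=f') , _) Ag@((g' , g⁻¹=g') , _) =
    (g' ∘P f' , inverse-∘P f f' g g' f⁻¹=f' g⁻¹=g') ,
    Weighted⇒bounds (f ∘P g) (Weighted-∘P (weight n) f g (Atilde⇒Weighted f Af) (Atilde⇒Weighted g Ag))

  Atilde-inverse : ∀ f g → Atilde d n f → InvMod n f g → Atilde d n g
  Atilde-inverse f g Af f⁻¹=g =
    (f , swap f⁻¹=g) ,
    Weighted⇒bounds g (InverseBounds.Weighted-inverse f g (Atilde⇒Weighted f Af) f⁻¹=g n ℕₚ.≤-refl)

theorem2p1 : ∀ {c ℓ} (R : CommutativeRing c ℓ) (q : CommutativeRing.Carrier R)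
    → Poly.TorsionFree R q → Poly.PrimePrincipal R q
    → (n d : ℕ) → 2 ≤ n → 1 ≤ d
    → Poly.Mod.IsSubgroup R q n (Poly.Mod.Atilde R q d n)
theorem2p1 R q torsion-free prime n d 2≤n 1≤d =
    (λ f → proj₁)
  , Atilde-resp
  , T∈Atilde
  , Atilde-∘P
  , Atilde-inverse
  where open AtildeSubgroup R q torsion-free prime d 1≤d n 2≤n
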